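{- Let $G$ be a graph, $k\ge 1$, with $V(G)=V_1\uplus\cdots\uplus V_k$ where each $V_i$ is an independent set in $G$, let $q$ be a prime power, and let $H$ be the graph constructed from $(G,k,q)$ as described below. If $G$ has a $k$-clique, then $H$ has a clique of size $q^k$.
   Context: Construction of $H$: let $n=|V(G)|$ and $d=\lceil \frac{3\log n}{\log q}+3\rceil$, and identify $V(G)$ with a linear Sidon set $S\subseteq\mathbb F_q^d$ of size $n$ (i.e., for all $a,b\in\mathbb F_q^*$ and $x,y,x',y'\in S$ with $x\ne y$, $x'\ne y'$, $ax+by=ax'+by'$ implies $\{x,y\}=\{x',y'\}$). For $r\in\mathbb F_q^k$ let the column $C_r=\{\mathrm{P}_{r,\pi}:\pi\in\mathbb F_q^d\}$ consist of distinct new vertices, and $V(H)=\bigcup_{r\in\mathbb F_q^k} C_r$. For $r\in\mathbb F_q^k$ write $e_i$ for the $i$-th unit vector and $\mathrm{Hamming}(r,r')$ for the number of coordinates where $r,r'$ differ. Edges between $\mathrm{P}_{r,\pi}$ and $\mathrm{P}_{r',\pi'}$: (H1) if $r=r'$, no edge; (H2) if $\mathrm{Hamming}(r,r')=1$, say $r'=r+ae_i$ with $a\in\mathbb F_q^*$, $i\in[k]$, there is an edge iff $\pi'-\pi=av$ for some $v\in V_i$; (H3) if $\mathrm{Hamming}(r,r')=2$, say $r'=r+ae_i+be_j$ with $a,b\in\mathbb F_q^*$ and distinct $i,j\in[k]$, there is an edge iff $\pi'-\pi=au+bv$ for some $u\in V_i$, $v\in V_j$ with $uv\in E(G)$; (H4)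 if $\mathrm{Hamming}(r,r')\ge 3$, there is an edge. -}

module Defs where

open import Level using (0ℓ)
open import Data.Nat using (ℕ; zero; suc; _≤_; _<_; _^_; _∸_)
open import Data.Nat.Primality using (Prime)
open import Data.Fin using (Fin) renaming (_≟_ to _≟ᶠ_)
open import Data.List using (length; filter; allFin)
open import Data.Product using (Σ; ∃; ∃-syntax; _×_; _,_)
open import Data.Sum using (_⊎_)
open import Relation.Nullary using (¬_; ¬?; does)
open import Relation.Binary.PropositionalEquality using (_≡_; _≢_)
open import Relation.Binary.Definitions using (DecidableEquality)
open import Algebra.Structures using (IsCommutativeRing)
open import Function.Bundles using (_↔_)
open import Data.Bool using (if_then_else_)

record Field : Set₁ where
  infixl 7 _*_
  infixl 6 _+_
  field
    Carrier : Set
    _+_ _*_ : Carrier → Carrier → Carrier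
    -_      : Carrier → Carrier
    0# 1#   : Carrier
    isCommutativeRing : IsCommutativeRing _≡_ _+_ _*_ -_ 0# 1#
    0≢1     : 0# ≢ 1#
    inverse : ∀ x → x ≢ 0# → ∃[ y ] (x * y ≡ 1#)
    _≟_     : DecidableEquality Carrier

HasSize : Field → ℕ → Set
HasSize F q = Field.Carrier F ↔ Fin q

IsPrimePower : ℕ → Set
IsPrimePower q = ∃[ p ] ∃[ e ] (Prime p × 1 ≤ e × q ≡ p ^ e)

module Vectors (F : Field) where
  open Field F

  Vec : ℕ → Set
  Vec m = Fin m → Carrier

  _⊕_ : ∀ {m} → Vec m → Vec m → Vec m
  (x ⊕ y) j = x j + y j

  _·_ : ∀ {m} → Carrier → Vec m → Vec m
  (a · x) j = a * x j

  _≋_ : ∀ {m} → Vec m → Vec m → Set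
  x ≋ y = ∀ j → x j ≡ y j

  e : ∀ {m} → Fin m → Vec m
  e i j = if does (i ≟ᶠ j) then 1# else 0#

  hamming : ∀ {m} → Vec m → Vec m → ℕ
  hamming {m} r r' = length (filter (λ i → ¬? (r i ≟ r' i)) (allFin m))

-- d = ⌈ 3 log n / log q + 3 ⌉, i.e. d = 3 + (least m with q^m ≥ n^3)
-- (for n ≥ 1, q ≥ 2: m ≥ 3 log_q n  ⇔  q^m ≥ n^3)

IsD : ℕ → ℕ → ℕ → Set
IsD n q d = 3 ≤ d × n ^ 3 ≤ q ^ (d ∸ 3) × (∀ m → m < d ∸ 3 → q ^ m < n ^ 3)

record SimpleGraph (n : ℕ) : Set₁ where
  field
    Adj   : Fin n → Fin n → Set
    sym   : ∀ {u v} → Adj u v → Adj v u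
    irrefl : ∀ {u} → ¬ Adj u u

-- partition V(G) = V_1 ⊎ ... ⊎ V_k into independent sets:
-- part v = the index i with v ∈ V_i
IsIndependentPartition : ∀ {n} → SimpleGraph n → (k : ℕ) → (Fin n → Fin k) → Set
IsIndependentPartition G k part =
  ∀ u v → SimpleGraph.Adj G u v → part u ≢ part v

-- a clique of size m in a graph with vertex type V and adjacency A:
-- m pairwise adjacent vertices (adjacency is irreflexive, so they are distinct)
HasClique : {V : Set} → (V → V → Set) → ℕ → Set
HasClique {V} A m = Σ (Fin m → V) λ f → ∀ i j → i ≢ j → A (f i) (f j)

module _ (F : Field) where
  open Field F
  open Vectors F

  IsLinearSidon : ∀ {n d} → (Fin n → Vec d) → Set
  IsLinearSidon {n} ι =
    (∀ u v → ι u ≋ ι v → u ≡ v) ×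
    (∀ (a b : Carrier) → a ≢ 0# → b ≢ 0# →
     ∀ (x y x' y' : Fin n) → x ≢ y → x' ≢ y' →
     ((a · ι x) ⊕ (b · ι y)) ≋ ((a · ι x') ⊕ (b · ι y')) →
     (x ≡ x' × y ≡ y') ⊎ (x ≡ y' × y ≡ x'))

  module H {n k d : ℕ} (G : SimpleGraph n) (part : Fin n → Fin k)
           (ι : Fin n → Vec d) where
    open SimpleGraph G

    Vertex : Set
    Vertex = Vec k × Vec d

    Edge : Vertex → Vertex → Set
    Edge (r , π) (r' , π') =
      (hamming r r' ≡ 1 ×
        Σ (Fin k) λ i → Σ Carrier λ a → a ≢ 0# × r' ≋ (r ⊕ (a · e i)) ×
        Σ (Fin n) λ v → part v ≡ i × π' ≋ (π ⊕ (a · ι v)))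
      ⊎
      (hamming r r' ≡ 2 ×
        Σ (Fin k) λ i → Σ (Fin k) λ j → i ≢ j ×
        Σ Carrier λ a → Σ Carrier λ b → a ≢ 0# × b ≢ 0# ×
        r' ≋ ((r ⊕ (a · e i)) ⊕ (b · e j)) ×
        Σ (Fin n) λ u → Σ (Fin n) λ v → part u ≡ i × part v ≡ j × Adj u v ×
        π' ≋ ((π ⊕ (a · ι u)) ⊕ (b · ι v)))
      ⊎
      -- (H4); (H1): Hamming 0 gives no edge
      (3 ≤ hamming r r')

module Submission where

-- Choose a transversal v of the k-clique with part (v i) ≡ i (the parts of the clique's vertices
-- are pairwise distinct, so every part is hit). Then the q^k vertices (r , Σᵢ rᵢ ι(vᵢ)), r ∈ F^k,
-- are pairwise adjacent: if r' differs from r exactly in coordinate i (in i and j), then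
-- r' = r + a eᵢ (+ b eⱼ) and by linearity the second components differ by a ι(vᵢ) (+ b ι(vⱼ)),
-- an (H2) (an (H3), since vᵢ vⱼ ∈ E(G)) edge; Hamming distance ≥ 3 is an edge outright.

open import Defs
open import Level using (0ℓ)
open import Algebra.Bundles using (CommutativeRing; Group)
import Algebra.Properties.Group as GroupProperties
import Algebra.Properties.Semiring.Sum as SemiringSum
open import Data.Nat using (ℕ; _≤_; _^_)
import Data.Nat.Properties as ℕ
open import Data.Fin using (Fin; zero; suc; punchOut) renaming (_≟_ to _≟ᶠ_)
open import Data.Fin.Base using (finToFun; funToFin; combine)
open import Data.Fin.Properties using (funToFin-finToFin; injective⇒≤; punchOut-injective; any?; ¬∀⟶∃¬)
open import Data.List using (List; []; _∷_; filter; allFin; length)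
open import Data.List.Membership.Propositional using (_∉_)
open import Data.List.Membership.Propositional.Properties using (∈-filter⁺; ∈-allFin)
open import Data.List.Relation.Unary.Any using (here; there)
open import Data.List.Relation.Unary.All using (All; []; _∷_)
open import Data.List.Relation.Unary.AllPairs using (_∷_)
open import Data.List.Relation.Unary.Unique.Propositional using (Unique)
import Data.List.Relation.Unary.Unique.Propositional.Properties as Unique
open import Data.List.Relation.Unary.All.Properties using (all-filter)
open import Data.Product using (Σ; ∃-syntax; _×_; _,_; proj₁; proj₂)
open import Data.Sum using (inj₁; inj₂)
open import Function using (_∘_; Injective; Surjective)
open import Function.Bundles using (_↔_; Inverse; Injection)
open import Function.Properties.Inverse using (↔-sym; ↔⇒↣)
open import Relation.Binary.Definitions using (DecidableEquality)
open import Relation.Nullary using (¬?; yes; no; contradiction)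
open import Relation.Binary.PropositionalEquality using (_≡_; _≢_; refl; sym; trans; cong; cong₂; subst; module ≡-Reasoning)

injective⇒surjective : ∀ {k} {σ : Fin k → Fin k} → Injective _≡_ _≡_ σ → Surjective _≡_ _≡_ σ
injective⇒surjective {ℕ.zero} _ ()
injective⇒surjective {ℕ.suc k} {σ} σ-inj i with any? (λ t → σ t ≟ᶠ i)
... | yes (t , σt≡i) = t , λ { refl → σt≡i }
... | no ∄t = contradiction (injective⇒≤ {f = τ} τ-inj) ℕ.1+n≰n
  where
  i≢σ : ∀ t → i ≢ σ t
  i≢σ t i≡σt = ∄t (t , sym i≡σt)
  τ : Fin (ℕ.suc k) → Fin k
  τ t = punchOut (i≢σ t)
  τ-inj : Injective _≡_ _≡_ τ
  τ-inj eq = σ-inj (punchOut-injective (i≢σ _) (i≢σ _) eq)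

funToFin-cong : ∀ {m q} {f g : Fin m → Fin q} → (∀ c → f c ≡ g c) → funToFin f ≡ funToFin g
funToFin-cong {ℕ.zero}  f≗g = refl
funToFin-cong {ℕ.suc m} f≗g = cong₂ combine (f≗g zero) (funToFin-cong (f≗g ∘ suc))

finToFun-injective : ∀ {m q} {x y : Fin (q ^ m)} → (∀ c → finToFun {q} {m} x c ≡ finToFun y c) → x ≡ y
finToFun-injective {m} {q} {x} {y} x≗y =
  trans (sym (funToFin-finToFin {m} {q} x))
        (trans (funToFin-cong {m} {q} x≗y) (funToFin-finToFin {m} {q} y))

module _ (F : Field) where
  open Field F
  open Vectors F

  ring : CommutativeRing 0ℓ 0ℓ
  ring = record { isCommutativeRing = isCommutativeRing }

  open CommutativeRing ring
    using (+-group; *-assoc; distribʳ; zeroˡ; zeroʳ; +-identityˡ; +-identityʳ; *-identityˡ; *-identityʳ)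
  open Group +-group using (_\\_)
  open GroupProperties +-group using (\\-leftDividesˡ)
  open SemiringSum (CommutativeRing.semiring ring)
    using (sum-syntax; sum-cong-≗; sum-replicate-zero; ∑-distrib-+; *-distribˡ-sum)
  open ≡-Reasoning

  \\-≢0# : ∀ {x y} → x ≢ y → x \\ y ≢ 0#
  \\-≢0# {x} {y} x≢y x\\y≡0 = x≢y (begin
    x            ≡⟨ +-identityʳ x ⟨
    x + 0#       ≡⟨ cong (x +_) x\\y≡0 ⟨
    x + (x \\ y) ≡⟨ \\-leftDividesˡ x y ⟩
    y            ∎)

  ⊕·e-self : ∀ {m} (r : Vec m) i a → (r ⊕ (a · e i)) i ≡ r i + a
  ⊕·e-self r i a with i ≟ᶠ i
  ... | yes _   = cong (r i +_) (*-identityʳ a)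
  ... | no i≢i = contradiction refl i≢i

  ⊕·e-other : ∀ {m} (r : Vec m) {i l} a → l ≢ i → (r ⊕ (a · e i)) l ≡ r l
  ⊕·e-other r {i} {l} a l≢i with i ≟ᶠ l
  ... | yes i≡l = contradiction (sym i≡l) l≢i
  ... | no _    = trans (cong (r l +_) (zeroʳ a)) (+-identityʳ (r l))

  ⊕·e-move : ∀ {m} (r r' : Vec m) i → (r ⊕ ((r i \\ r' i) · e i)) i ≡ r' i
  ⊕·e-move r r' i = trans (⊕·e-self r i (r i \\ r' i)) (\\-leftDividesˡ (r i) (r' i))

  ≋-move : ∀ {m} (r r' : Vec m) i → (∀ l → l ≢ i → r l ≡ r' l) → r' ≋ (r ⊕ ((r i \\ r' i) · e i))
  ≋-move r r' i agree l with l ≟ᶠ i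
  ... | yes refl = sym (⊕·e-move r r' i)
  ... | no l≢i  = sym (trans (⊕·e-other r _ l≢i) (agree l l≢i))

  ∑-e : ∀ {m} i (x : Fin m → Carrier) → ∑[ j < m ] (e i j * x j) ≡ x i
  ∑-e {ℕ.suc m} zero x = begin
    1# * x zero + ∑[ j < m ] (0# * x (suc j))  ≡⟨ cong₂ _+_ (*-identityˡ (x zero)) (sum-cong-≗ (zeroˡ ∘ x ∘ suc)) ⟩
    x zero + ∑[ j < m ] 0#                      ≡⟨ cong (x zero +_) (sum-replicate-zero m) ⟩
    x zero + 0#                                 ≡⟨ +-identityʳ (x zero) ⟩
    x zero                                      ∎
  ∑-e {ℕ.suc m} (suc i) x = begin
    0# * x zero + ∑[ j < m ] (e i j * x (suc j))  ≡⟨ cong₂ _+_ (zeroˡ (x zero)) (∑-e i (x ∘ suc)) ⟩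
    0# + x (suc i)                                ≡⟨ +-identityˡ (x (suc i)) ⟩
    x (suc i)                                     ∎

  combination : ∀ {k d} → (Fin k → Vec d) → Vec k → Vec d
  combination {k} w r c = ∑[ j < k ] (r j * w j c)

  combination-cong : ∀ {k d} (w : Fin k → Vec d) {r r'} → r ≋ r' → combination w r ≋ combination w r'
  combination-cong w r≋r' c = sum-cong-≗ (λ j → cong (_* w j c) (r≋r' j))

  combination-⊕·e : ∀ {k d} (w : Fin k → Vec d) r i a →
                    combination w (r ⊕ (a · e i)) ≋ (combination w r ⊕ (a · w i))
  combination-⊕·e {k} w r i a c = begin
    ∑[ j < k ] ((r j + a * e i j) * w j c)
      ≡⟨ sum-cong-≗ (λ j → trans (distribʳ (w j c) (r j) _) (cong (r j * w j c +_) (*-assoc a (e i j) (w j c)))) ⟩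
    ∑[ j < k ] (r j * w j c + a * (e i j * w j c))
      ≡⟨ ∑-distrib-+ (λ j → r j * w j c) (λ j → a * (e i j * w j c)) ⟩
    combination w r c + ∑[ j < k ] (a * (e i j * w j c))
      ≡⟨ cong (combination w r c +_) (*-distribˡ-sum a (λ j → e i j * w j c)) ⟨
    combination w r c + a * ∑[ j < k ] (e i j * w j c)
      ≡⟨ cong (λ x → combination w r c + a * x) (∑-e i (λ j → w j c)) ⟩
    combination w r c + a * w i c
      ∎

  differing : ∀ {m} → Vec m → Vec m → List (Fin m)
  differing {m} r r' = filter (λ i → ¬? (r i ≟ r' i)) (allFin m)

  differing-unique : ∀ {m} (r r' : Vec m) → Unique (differing r r')
  differing-unique {m} r r' = Unique.filter⁺ (λ i → ¬? (r i ≟ r' i)) (Unique.allFin⁺ m)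

  differing-differ : ∀ {m} (r r' : Vec m) → All (λ i → r i ≢ r' i) (differing r r')
  differing-differ {m} r r' = all-filter (λ i → ¬? (r i ≟ r' i)) (allFin m)

  agree-outside-differing : ∀ {m} (r r' : Vec m) l → l ∉ differing r r' → r l ≡ r' l
  agree-outside-differing r r' l l∉ with r l ≟ r' l
  ... | yes rl≡r'l = rl≡r'l
  ... | no rl≢r'l  = contradiction (∈-filter⁺ (λ i → ¬? (r i ≟ r' i)) (∈-allFin l) rl≢r'l) l∉

  module TransversalClique {n k d} (G : SimpleGraph n) (part : Fin n → Fin k) (ι : Fin n → Vec d)
    (v : Fin k → Fin n) (v-part : ∀ i → part (v i) ≡ i)
    (v-adj : ∀ i j → i ≢ j → SimpleGraph.Adj G (v i) (v j)) where

    open H F G part ι using (Vertex; Edge)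

    w : Fin k → Vec d
    w = ι ∘ v

    vertex : Vec k → Vertex
    vertex r = r , combination w r

    edge-one : ∀ {r r' i} → hamming r r' ≡ 1 → r i ≢ r' i → (∀ l → l ≢ i → r l ≡ r' l) →
               Edge (vertex r) (vertex r')
    edge-one {r} {r'} {i} h≡1 ri≢r'i agree =
      inj₁ (h≡1 , i , a , \\-≢0# ri≢r'i , r'≋ , v i , v-part i , λ c →
        trans (combination-cong w r'≋ c) (combination-⊕·e w r i a c))
      where
      a = r i \\ r' i
      r'≋ = ≋-move r r' i agree

    edge-two : ∀ {r r' i j} → hamming r r' ≡ 2 → i ≢ j → r i ≢ r' i → r j ≢ r' j →
               (∀ l → l ≢ i → l ≢ j → r l ≡ r' l) → Edge (vertex r) (vertex r')
    edge-two {r} {r'} {i} {j} h≡2 i≢j ri≢r'i rj≢r'j agree =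
      inj₂ (inj₁ (h≡2 , i , j , i≢j , a , b , \\-≢0# ri≢r'i , \\-≢0# sj≢r'j , r'≋ ,
                  v i , v j , v-part i , v-part j , v-adj i j i≢j , λ c →
        trans (combination-cong w r'≋ c)
              (trans (combination-⊕·e w s j b c) (cong (_+ b * w j c) (combination-⊕·e w r i a c)))))
      where
      a = r i \\ r' i
      s = r ⊕ (a · e i)
      b = s j \\ r' j
      sj≢r'j : s j ≢ r' j
      sj≢r'j = rj≢r'j ∘ trans (sym (⊕·e-other r a (i≢j ∘ sym)))
      s-agree : ∀ l → l ≢ j → s l ≡ r' l
      s-agree l l≢j with l ≟ᶠ i
      ... | yes refl = ⊕·e-move r r' i
      ... | no l≢i  = trans (⊕·e-other r a l≢i) (agree l l≢i l≢j)
      r'≋ = ≋-move s r' j s-agree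

    edge-from-support : ∀ {r r' c} (xs : List (Fin k)) → Unique xs → All (λ i → r i ≢ r' i) xs →
                        (∀ l → l ∉ xs → r l ≡ r' l) → length xs ≡ hamming r r' → r c ≢ r' c →
                        Edge (vertex r) (vertex r')
    edge-from-support {c = c} [] _ _ agree _ rc≢r'c = contradiction (agree c λ ()) rc≢r'c
    edge-from-support (_ ∷ []) _ (ri≢r'i ∷ []) agree len _ =
      edge-one (sym len) ri≢r'i λ l l≢i → agree l λ { (here l≡i) → l≢i l≡i }
    edge-from-support (_ ∷ _ ∷ []) ((i≢j ∷ []) ∷ _) (ri≢r'i ∷ rj≢r'j ∷ []) agree len _ =
      edge-two (sym len) i≢j ri≢r'i rj≢r'j λ l l≢i l≢j →
        agree l λ { (here l≡i) → l≢i l≡i ; (there (here l≡j)) → l≢j l≡j }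
    edge-from-support (_ ∷ _ ∷ _ ∷ xs) _ _ _ len _ =
      inj₂ (inj₂ (subst (3 ≤_) len (ℕ.m≤m+n 3 (length xs))))

    vertex-edge : ∀ {r r'} → ∃[ c ] r c ≢ r' c → Edge (vertex r) (vertex r')
    vertex-edge {r} {r'} (c , rc≢r'c) =
      edge-from-support (differing r r') (differing-unique r r') (differing-differ r r')
        (agree-outside-differing r r') refl rc≢r'c

clique⇒transversal : ∀ {n k} (G : SimpleGraph n) (part : Fin n → Fin k) →
  IsIndependentPartition G k part → HasClique (SimpleGraph.Adj G) k →
  Σ (Fin k → Fin n) λ v → (∀ i → part (v i) ≡ i) × (∀ i j → i ≢ j → SimpleGraph.Adj G (v i) (v j))
clique⇒transversal {k = k} G part independent (f , f-adj) =
  f ∘ t , t-part , λ i j i≢j → f-adj (t i) (t j) (i≢j ∘ t-injective)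
  where
  σ-injective : Injective _≡_ _≡_ (part ∘ f)
  σ-injective {x} {y} σx≡σy with x ≟ᶠ y
  ... | yes x≡y = x≡y
  ... | no x≢y  = contradiction σx≡σy (independent (f x) (f y) (f-adj x y x≢y))
  t : Fin k → Fin k
  t i = proj₁ (injective⇒surjective σ-injective i)
  t-part : ∀ i → part (f (t i)) ≡ i
  t-part i = proj₂ (injective⇒surjective σ-injective i) refl
  t-injective : ∀ {i j} → t i ≡ t j → i ≡ j
  t-injective {i} {j} ti≡tj = trans (sym (t-part i)) (trans (cong (part ∘ f) ti≡tj) (t-part j))

module _ {A : Set} {q} (A↔Fin : A ↔ Fin q) (_≟_ : DecidableEquality A) where
  open Inverse A↔Fin using (from)

  enumerate : ∀ {k} → Fin (q ^ k) → (Fin k → A)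
  enumerate x c = from (finToFun x c)

  enumerate-separates : ∀ {k} {x y : Fin (q ^ k)} → x ≢ y → ∃[ c ] enumerate x c ≢ enumerate y c
  enumerate-separates {k} {x} {y} x≢y =
    ¬∀⟶∃¬ k (λ c → enumerate x c ≡ enumerate y c) (λ c → enumerate x c ≟ enumerate y c)
      λ x≗y → x≢y (finToFun-injective (Injection.injective (↔⇒↣ (↔-sym A↔Fin)) ∘ x≗y))

lemma3 : (n k q d : ℕ) (G : SimpleGraph n) (part : Fin n → Fin k) (F : Field)
    (ι : Fin n → Vectors.Vec F d) →
    1 ≤ k → IsIndependentPartition G k part →
    IsPrimePower q → HasSize F q → IsD n q d → IsLinearSidon F ι →
    HasClique (SimpleGraph.Adj G) k →
    HasClique (H.Edge F G part ι) (q ^ k)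
lemma3 n k q d G part F ι _ independent _ size _ _ clique
  with v , v-part , v-adj ← clique⇒transversal G part independent clique =
  let open TransversalClique F G part ι v v-part v-adj
      open Field F using (_≟_)
  in vertex ∘ enumerate size _≟_ , λ x y x≢y → vertex-edge (enumerate-separates size _≟_ x≢y)
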